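{- Let $1\le t<k\le n$ and $s\ge2$. Let $T_1,\dots,T_{s-1},T_1^*\in\binom{[n]}{t}$, let $X\in\binom{[n]}{t}$ and $C\in\binom{[n]}{k+1}$ with $X\subseteq C$, and let $Z\in\binom{[n]}{t+2}$. (i) If $T_1\cap\big(\bigcup_{i=2}^{s-1}T_i\cup C\cup X\big)\ne\emptyset$ and $T_1^*\cap\big(\bigcup_{i=2}^{s-1}T_i\cup C\cup X\big)=\emptyset$, then $|\mathcal{G}_1(T_1,T_2,\dots,T_{s-1},X,C)|\le|\mathcal{G}_1(T_1^*,T_2,\dots,T_{s-1},X,C)|$. (ii) If $T_1\cap\big(\bigcup_{i=2}^{s-1}T_i\cup Z\big)\ne\emptyset$ and $T_1^*\cap\big(\bigcup_{i=2}^{s-1}T_i\cup Z\big)=\emptyset$, then $|\mathcal{G}_2(T_1,T_2,\dots,T_{s-1},Z)|\le|\mathcal{G}_2(T_1^*,T_2,\dots,T_{s-1},Z)|$.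
   Context: For $T\in\binom{[n]}{t}$, $\mathcal{S}(T)=\{F\in\binom{[n]}{k}:T\subseteq F\}$. For $X\in\binom{[n]}{t}$, $X\subseteq C\in\binom{[n]}{k+1}$, let $\mathcal{H}_1(X,C)=\{F\in\binom{[n]}{k}:X\subseteq F,\ F\cap(C\setminus X)\ne\emptyset\}\cup\{C\setminus\{i\}:i\in C\}$. For $Z\in\binom{[n]}{t+2}$, let $\mathcal{H}_2(Z)=\{F\in\binom{[n]}{k}:|F\cap Z|\ge t+1\}$. Define $\mathcal{G}_1(T_1,\dots,T_{s-1},X,C)=\bigcup_{i=1}^{s-1}\mathcal{S}(T_i)\cup\mathcal{H}_1(X,C)$ and $\mathcal{G}_2(T_1,\dots,T_{s-1},Z)=\bigcup_{i=1}^{s-1}\mathcal{S}(T_i)\cup\mathcal{H}_2(Z)$. -}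

module Defs where

open import Data.Nat using (ℕ; zero; suc)
open import Data.Bool using (Bool; true; false)
open import Data.Vec using (Vec; []; _∷_)
open import Data.List using (List; []; _∷_; map; _++_; filter; length)
open import Data.Fin using (Fin)
open import Data.Fin.Subset using (Subset; _⊆_; _∩_; _∪_; _─_; _-_; _∈_; ∣_∣; Nonempty; ⊥)
open import Data.Fin.Subset.Properties using (_⊆?_; nonempty?; _∈?_)
open import Data.Fin.Properties using (any?)
open import Data.Product using (∃; _×_; _,_)
open import Data.Sum using (_⊎_)
open import Relation.Nullary using (Dec; yes; no; ¬_)
open import Relation.Nullary.Decidable using (_×-dec_; _⊎-dec_)
import Agda.Primitive
open import Relation.Unary using (Pred; Decidable)
open import Relation.Binary.PropositionalEquality using (_≡_)
import Data.Vec.Properties as VP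
import Data.Bool.Properties as BP

allSubsets : (n : ℕ) → List (Subset n)
allSubsets zero = [] ∷ []
allSubsets (suc n) = map (true ∷_) (allSubsets n) ++ map (false ∷_) (allSubsets n)

card : ∀ {n} (P : Pred (Subset n) Agda.Primitive.lzero) → Decidable P → ℕ
card {n} P P? = length (filter P? (allSubsets n))

_≟S_ : ∀ {n} (A B : Subset n) → Dec (A ≡ B)
_≟S_ = VP.≡-dec BP._≟_

Sized : ∀ {n} → ℕ → Subset n → Set
Sized k F = ∣ F ∣ ≡ k

𝒮 : ∀ {n} (k : ℕ) (T : Subset n) → Subset n → Set
𝒮 k T F = Sized k F × T ⊆ F

ℋ₁ : ∀ {n} (k : ℕ) (X C : Subset n) → Subset n → Set
ℋ₁ k X C F = Sized k F × ((X ⊆ F × Nonempty (F ∩ (C ─ X))) ⊎ ∃ λ i → i ∈ C × F ≡ C - i)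

ℋ₂ : ∀ {n} (k t : ℕ) (Z : Subset n) → Subset n → Set
ℋ₂ k t Z F = Sized k F × Data.Nat._≤_ (suc t) ∣ F ∩ Z ∣
  where import Data.Nat

⋃𝒮 : ∀ {n} (k : ℕ) → List (Subset n) → Subset n → Set
⋃𝒮 k [] F = Data.Empty.⊥
  where import Data.Empty
⋃𝒮 k (T ∷ Ts) F = 𝒮 k T F ⊎ ⋃𝒮 k Ts F

𝒢₁ : ∀ {n} (k : ℕ) (Ts : List (Subset n)) (X C : Subset n) → Subset n → Set
𝒢₁ k Ts X C F = ⋃𝒮 k Ts F ⊎ ℋ₁ k X C F

𝒢₂ : ∀ {n} (k t : ℕ) (Ts : List (Subset n)) (Z : Subset n) → Subset n → Set
𝒢₂ k t Ts Z F = ⋃𝒮 k Ts F ⊎ ℋ₂ k t Z F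

Sized? : ∀ {n} k → Decidable (Sized {n} k)
Sized? k F = Data.Nat._≟_ ∣ F ∣ k
  where import Data.Nat

𝒮? : ∀ {n} k (T : Subset n) → Decidable (𝒮 k T)
𝒮? k T F = Sized? k F ×-dec (T ⊆? F)

ℋ₁? : ∀ {n} k (X C : Subset n) → Decidable (ℋ₁ k X C)
ℋ₁? k X C F = Sized? k F ×-dec (((X ⊆? F) ×-dec nonempty? (F ∩ (C ─ X)))
  ⊎-dec any? (λ i → (i ∈? C) ×-dec (F ≟S (C - i))))

ℋ₂? : ∀ {n} k t (Z : Subset n) → Decidable (ℋ₂ k t Z)
ℋ₂? k t Z F = Sized? k F ×-dec Data.Nat._≤?_ (suc t) ∣ F ∩ Z ∣
  where import Data.Nat

⋃𝒮? : ∀ {n} k (Ts : List (Subset n)) → Decidable (⋃𝒮 k Ts)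
⋃𝒮? k [] F = no λ ()
⋃𝒮? k (T ∷ Ts) F = 𝒮? k T F ⊎-dec ⋃𝒮? k Ts F

𝒢₁? : ∀ {n} k (Ts : List (Subset n)) (X C : Subset n) → Decidable (𝒢₁ k Ts X C)
𝒢₁? k Ts X C F = ⋃𝒮? k Ts F ⊎-dec ℋ₁? k X C F

𝒢₂? : ∀ {n} k t (Ts : List (Subset n)) (Z : Subset n) → Decidable (𝒢₂ k t Ts Z)
𝒢₂? k t Ts Z F = ⋃𝒮? k Ts F ⊎-dec ℋ₂? k t Z F

∣𝒢₁∣ : ∀ {n} k (Ts : List (Subset n)) (X C : Subset n) → ℕ
∣𝒢₁∣ k Ts X C = card (𝒢₁ k Ts X C) (𝒢₁? k Ts X C)

∣𝒢₂∣ : ∀ {n} k t (Ts : List (Subset n)) (Z : Subset n) → ℕ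
∣𝒢₂∣ k t Ts Z = card (𝒢₂ k t Ts Z) (𝒢₂? k t Ts Z)

⋃ : ∀ {n} → List (Subset n) → Subset n
⋃ {n} = Data.List.foldr _∪_ ⊥
  where import Data.List

-- Shifting.  Write each family as 𝒮(T₁) ∪ 𝒬 with 𝒬 the part not depending on T₁.  For d ∈ T₁ and
-- e ∈ T₁*, move the members F ∈ 𝒮(T₁) ∖ 𝒬 by the transposition (d e) and fix all other members.
-- Since e lies outside every set 𝒬 refers to, 𝒬 is closed under undoing such a move (if (d e)F ∈ 𝒬
-- then F ∈ 𝒬), which makes the map injective into 𝒮((d e)T₁) ∪ 𝒬.  Each move brings T₁ one
-- element closer to T₁*, so iterating gives the inequality.
module Submission where

open import Level using (0ℓ)
open import Data.Nat using (ℕ; zero; suc; _≤_; _<_; _∸_; z≤n; s≤s)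
open import Data.Nat.Properties using (≤-refl; ≤-trans; ≤-reflexive; <-irrefl; <-≤-trans)
open import Data.Bool using (true; false)
open import Data.Vec using (Vec; []; _∷_; toList; tabulate; lookup; here; there)
open import Data.Vec.Properties using ([]=⇒lookup; lookup⇒[]=; lookup∘tabulate; ∷-injectiveʳ)
open import Data.Vec.Relation.Unary.All using (All)
open import Data.List using (List; []; _∷_; map; _++_; filter; length)
open import Data.List.Properties using (filter-notAll)
open import Data.List.Relation.Unary.Any using (here; there)
import Data.List.Relation.Unary.Any as Any
open import Data.List.Relation.Unary.All using ([]; _∷_)
import Data.List.Relation.Unary.All as ListAll
open import Data.List.Relation.Unary.AllPairs using ([]; _∷_)
open import Data.List.Relation.Unary.Unique.Propositional using (Unique)
import Data.List.Relation.Unary.Unique.Propositional.Properties as Unique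
open import Data.List.Membership.Propositional using () renaming (_∈_ to _∈ₗ_)
open import Data.List.Membership.Propositional.Properties
  using (∈-filter⁺; ∈-filter⁻; ∈-map⁺; ∈-map⁻; ∈-++⁺ˡ; ∈-++⁺ʳ)
open import Data.Fin using (Fin; zero; suc; _≟_)
open import Data.Fin.Permutation.Components using (transpose)
open import Data.Fin.Subset hiding (⋃)
open import Data.Fin.Subset.Properties
open import Data.Product using (_×_; _,_; proj₁; proj₂)
open import Data.Sum using (_⊎_; inj₁; inj₂; assocʳ; assocˡ)
open import Data.Empty using (⊥-elim)
open import Relation.Nullary using (Dec; yes; no; ¬_)
open import Relation.Nullary.Decidable using (dec-true; dec-false)
open import Relation.Unary using (Pred; Decidable) renaming (_∪_ to _∪ₚ_; _⊆_ to _⊆ₚ_)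
open import Relation.Unary.Properties using (_∩?_; ∁?) renaming (_∪?_ to _∪ₚ?_)
open import Relation.Binary.Definitions using (DecidableEquality)
open import Relation.Binary.PropositionalEquality using (_≡_; _≢_; refl; sym; trans; cong; subst; module ≡-Reasoning)
open import Defs

private variable n : ℕ

module _ {a b} {A : Set a} {B : Set b} (_≟B_ : DecidableEquality B) (f : A → B) where

  length-≤-by-injection : ∀ {xs : List A} {ys : List B} → Unique xs →
    (∀ {x y} → x ∈ₗ xs → y ∈ₗ xs → f x ≡ f y → x ≡ y) →
    (∀ {x} → x ∈ₗ xs → f x ∈ₗ ys) → length xs ≤ length ys
  length-≤-by-injection {[]}     _               _   _    = z≤n
  length-≤-by-injection {x ∷ xs} {ys} (x∉xs ∷ xs!) inj into =
    ≤-trans (s≤s (length-≤-by-injection xs! inj′ into′))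
            (filter-notAll (∁? ≟fx) ys (Any.map (λ fx≡y y≢fx → y≢fx (sym fx≡y)) (into (here refl))))
    where
    ≟fx : ∀ y → Dec (y ≡ f x)
    ≟fx y = y ≟B f x
    inj′ : ∀ {y z} → y ∈ₗ xs → z ∈ₗ xs → f y ≡ f z → y ≡ z
    inj′ y∈ z∈ = inj (there y∈) (there z∈)
    into′ : ∀ {z} → z ∈ₗ xs → f z ∈ₗ filter (∁? ≟fx) ys
    into′ z∈ = ∈-filter⁺ (∁? ≟fx) (into (there z∈))
      (λ fz≡fx → ListAll.lookup x∉xs z∈ (inj (here refl) (there z∈) (sym fz≡fx)))

∈-allSubsets : ∀ n (F : Subset n) → F ∈ₗ allSubsets n
∈-allSubsets zero    []          = here refl
∈-allSubsets (suc n) (true ∷ F)  = ∈-++⁺ˡ (∈-map⁺ (true ∷_) (∈-allSubsets n F))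
∈-allSubsets (suc n) (false ∷ F) =
  ∈-++⁺ʳ (map (true ∷_) (allSubsets n)) (∈-map⁺ (false ∷_) (∈-allSubsets n F))

allSubsets-unique : ∀ n → Unique (allSubsets n)
allSubsets-unique zero    = [] ∷ []
allSubsets-unique (suc n) =
  Unique.++⁺ (Unique.map⁺ ∷-injectiveʳ (allSubsets-unique n))
             (Unique.map⁺ ∷-injectiveʳ (allSubsets-unique n)) disjoint
  where
  disjoint : ∀ {v} → ¬ (v ∈ₗ map (true ∷_) (allSubsets n) × v ∈ₗ map (false ∷_) (allSubsets n))
  disjoint (v∈₁ , v∈₂) with ∈-map⁻ (true ∷_) v∈₁ | ∈-map⁻ (false ∷_) v∈₂
  ... | _ , _ , refl | _ , _ , ()

module _ (P Q : Pred (Subset n) 0ℓ) (P? : Decidable P) (Q? : Decidable Q) where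

  card-≤-by-injection : (f : Subset n → Subset n) → (∀ {F} → P F → Q (f F)) →
    (∀ {F G} → P F → P G → f F ≡ f G → F ≡ G) → card P P? ≤ card Q Q?
  card-≤-by-injection f into inj =
    length-≤-by-injection _≟S_ f (Unique.filter⁺ P? (allSubsets-unique n))
      (λ F∈ G∈ → inj (satisfies F∈) (satisfies G∈))
      (λ {F} F∈ → ∈-filter⁺ Q? (∈-allSubsets n (f F)) (into (satisfies F∈)))
    where
    satisfies : ∀ {F} → F ∈ₗ filter P? (allSubsets n) → P F
    satisfies F∈ = proj₂ (∈-filter⁻ P? {xs = allSubsets n} F∈)

  card-mono : P ⊆ₚ Q → card P P? ≤ card Q Q?
  card-mono P⊆Q = card-≤-by-injection (λ F → F) P⊆Q (λ _ _ eq → eq)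

x∈p─q⇒x∉q : ∀ {x : Fin n} {p q} → x ∈ p ─ q → x ∉ q
x∈p─q⇒x∉q {x = zero}  {_ ∷ p} {inside ∷ q}  ()
x∈p─q⇒x∉q {x = zero}  {_ ∷ p} {outside ∷ q} _ ()
x∈p─q⇒x∉q {x = suc x} {_ ∷ p} {_ ∷ q} (there x∈) (there x∈q) = x∈p─q⇒x∉q x∈ x∈q

x∈p-y⇒x≢y : ∀ {x y : Fin n} {p} → x ∈ p - y → x ≢ y
x∈p-y⇒x≢y x∈ = x∉⁅y⁆⇒x≢y (x∈p─q⇒x∉q x∈)

x∈p⇒∣p∣≡1+∣p-x∣ : ∀ {x : Fin n} {p} → x ∈ p → ∣ p ∣ ≡ suc ∣ p - x ∣
x∈p⇒∣p∣≡1+∣p-x∣ {x = zero}  {inside ∷ p}  here       = cong suc (cong ∣_∣ (sym (p─⊥≡p p)))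
x∈p⇒∣p∣≡1+∣p-x∣ {x = suc x} {inside ∷ p}  (there x∈) = cong suc (x∈p⇒∣p∣≡1+∣p-x∣ x∈)
x∈p⇒∣p∣≡1+∣p-x∣ {x = suc x} {outside ∷ p} (there x∈) = x∈p⇒∣p∣≡1+∣p-x∣ x∈

Empty[p─q]⇒p⊆q : ∀ {p q : Subset n} → Empty (p ─ q) → p ⊆ q
Empty[p─q]⇒p⊆q {q = q} empty {x} x∈p with x ∈? q
... | yes x∈q = x∈q
... | no  x∉q = ⊥-elim (empty (x , x∈p∧x∉q⇒x∈p─q x∈p x∉q))

p⊆q∧∣p∣≡∣q∣⇒p≡q : ∀ {p q : Subset n} → p ⊆ q → ∣ p ∣ ≡ ∣ q ∣ → p ≡ q
p⊆q∧∣p∣≡∣q∣⇒p≡q {p = p} {q} p⊆q ∣p∣≡∣q∣ with nonempty? (q ─ p)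
... | yes (x , x∈q─p) = ⊥-elim (<-irrefl ∣p∣≡∣q∣
        (p⊂q⇒∣p∣<∣q∣ (p⊆q , x , p─q⊆p q p x∈q─p , x∈p─q⇒x∉q x∈q─p)))
... | no  q─p-empty  = ⊆-antisym p⊆q (Empty[p─q]⇒p⊆q q─p-empty)

module _ (d e : Fin n) where

  transpose-left : transpose d e d ≡ e
  transpose-left rewrite dec-true (d ≟ d) refl = refl

  transpose-right : transpose d e e ≡ d
  transpose-right with e ≟ d
  ... | yes e≡d = e≡d
  ... | no  e≢d rewrite dec-true (e ≟ e) refl = refl

  transpose-other : ∀ {x} → x ≢ d → x ≢ e → transpose d e x ≡ x
  transpose-other {x} x≢d x≢e rewrite dec-false (x ≟ d) x≢d | dec-false (x ≟ e) x≢e = refl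

  transpose-involutive : ∀ x → transpose d e (transpose d e x) ≡ x
  transpose-involutive x = by-cases (x ≟ d) (x ≟ e)
    where
    by-cases : Dec (x ≡ d) → Dec (x ≡ e) → transpose d e (transpose d e x) ≡ x
    by-cases (yes refl) _          = trans (cong (transpose d e) transpose-left) transpose-right
    by-cases (no _)     (yes refl) = trans (cong (transpose d e) transpose-right) transpose-left
    by-cases (no x≢d)   (no x≢e)   =
      trans (cong (transpose d e) (transpose-other x≢d x≢e)) (transpose-other x≢d x≢e)

swap : Fin n → Fin n → Subset n → Subset n
swap d e F = tabulate (λ x → lookup F (transpose d e x))

module _ {d e : Fin n} {F : Subset n} where

  ∈-swap⁻ : ∀ {x} → x ∈ swap d e F → transpose d e x ∈ F
  ∈-swap⁻ {x} x∈ = lookup⇒[]= _ F (trans (sym (lookup∘tabulate _ x)) ([]=⇒lookup x∈))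

  ∈-swap⁺ : ∀ {x} → transpose d e x ∈ F → x ∈ swap d e F
  ∈-swap⁺ {x} x∈ = lookup⇒[]= x _ (trans (lookup∘tabulate _ x) ([]=⇒lookup x∈))

  ∈⇒swapped-∈ : ∀ {x y} → transpose d e x ≡ y → y ∈ F → x ∈ swap d e F
  ∈⇒swapped-∈ τx≡y y∈ = ∈-swap⁺ (subst (_∈ F) (sym τx≡y) y∈)

  ∈-swap⇒∈ : d ∈ F → ∀ {x} → x ≢ e → x ∈ swap d e F → x ∈ F
  ∈-swap⇒∈ d∈F {x} x≢e x∈ with x ≟ d
  ... | yes refl = d∈F
  ... | no  x≢d  = subst (_∈ F) (transpose-other d e x≢d x≢e) (∈-swap⁻ x∈)

  ∣swap∣ : d ∈ F → ∣ swap d e F ∣ ≡ ∣ F ∣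
  ∣swap∣ d∈F with e ∈? F
  ... | yes e∈F = cong ∣_∣ (⊆-antisym swap⊆F F⊆swap)
    where
    swap⊆F : swap d e F ⊆ F
    swap⊆F {x} x∈ with x ≟ e
    ... | yes refl = e∈F
    ... | no  x≢e  = ∈-swap⇒∈ d∈F x≢e x∈
    F⊆swap : F ⊆ swap d e F
    F⊆swap {x} x∈ with x ≟ d | x ≟ e
    ... | yes refl | _        = ∈⇒swapped-∈ (transpose-left d e) e∈F
    ... | no _     | yes refl = ∈⇒swapped-∈ (transpose-right d e) d∈F
    ... | no x≢d   | no x≢e   = ∈⇒swapped-∈ (transpose-other d e x≢d x≢e) x∈
  ... | no  e∉F = begin
    ∣ swap d e F ∣          ≡⟨ x∈p⇒∣p∣≡1+∣p-x∣ (∈⇒swapped-∈ (transpose-right d e) d∈F) ⟩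
    suc ∣ swap d e F - e ∣  ≡⟨ cong (λ p → suc ∣ p ∣) (⊆-antisym swap-e⊆F-d F-d⊆swap-e) ⟩
    suc ∣ F - d ∣           ≡⟨ x∈p⇒∣p∣≡1+∣p-x∣ d∈F ⟨
    ∣ F ∣                   ∎
    where
    open ≡-Reasoning
    swap-e⊆F-d : swap d e F - e ⊆ F - d
    swap-e⊆F-d {x} x∈ with x ≟ d
    ... | yes refl = ⊥-elim (e∉F (subst (_∈ F) (transpose-left d e) (∈-swap⁻ (p─q⊆p _ _ x∈))))
    ... | no  x≢d  = x∈p∧x≢y⇒x∈p-y (∈-swap⇒∈ d∈F (x∈p-y⇒x≢y x∈) (p─q⊆p _ _ x∈)) x≢d
    F-d⊆swap-e : F - d ⊆ swap d e F - e
    F-d⊆swap-e {x} x∈ = x∈p∧x≢y⇒x∈p-y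
      (∈⇒swapped-∈ (transpose-other d e (x∈p-y⇒x≢y x∈) x≢e) (p─q⊆p _ _ x∈)) x≢e
      where
      x≢e : x ≢ e
      x≢e refl = e∉F (p─q⊆p _ _ x∈)

swap-involutive : ∀ (d e : Fin n) F → swap d e (swap d e F) ≡ F
swap-involutive d e F = ⊆-antisym
  (λ {x} x∈ → subst (_∈ F) (transpose-involutive d e x) (∈-swap⁻ (∈-swap⁻ x∈)))
  (λ {x} x∈ → ∈-swap⁺ (∈-swap⁺ (subst (_∈ F) (sym (transpose-involutive d e x)) x∈)))

swap-mono : ∀ {d e : Fin n} {T F} → T ⊆ F → swap d e T ⊆ swap d e F
swap-mono T⊆F x∈ = ∈-swap⁺ (T⊆F (∈-swap⁻ x∈))

swap-∈⇒∈ : ∀ {d e : Fin n} {F S} → d ∈ F → e ∉ S → ∀ {x} → x ∈ S → x ∈ swap d e F → x ∈ F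
swap-∈⇒∈ d∈F e∉S x∈S = ∈-swap⇒∈ d∈F (λ { refl → e∉S x∈S })

swap-⊂-─ : ∀ {d e : Fin n} {T T*} → d ∈ T → d ∉ T* → e ∈ T* → e ∉ T → T* ─ swap d e T ⊂ T* ─ T
swap-⊂-─ {d = d} {e} {T} {T*} d∈T d∉T* e∈T* e∉T =
  ⊆-─ , e , x∈p∧x∉q⇒x∈p─q e∈T* e∉T , λ e∈ → x∈p─q⇒x∉q e∈ e∈swap
  where
  e∈swap : e ∈ swap d e T
  e∈swap = ∈⇒swapped-∈ (transpose-right d e) d∈T
  ⊆-─ : T* ─ swap d e T ⊆ T* ─ T
  ⊆-─ {x} x∈ = x∈p∧x∉q⇒x∈p─q x∈T* x∉T
    where
    x∈T* : x ∈ T*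
    x∈T* = p─q⊆p _ _ x∈
    x∉T : x ∉ T
    x∉T x∈T with x ≟ d | x ≟ e
    ... | yes refl | _        = d∉T* x∈T*
    ... | no _     | yes refl = e∉T x∈T
    ... | no x≢d   | no x≢e   = x∈p─q⇒x∉q x∈ (∈⇒swapped-∈ (transpose-other d e x≢d x≢e) x∈T)

ShiftClosed : ℕ → Fin n → Pred (Subset n) 0ℓ → Set
ShiftClosed k e 𝒬 = ∀ {d F} → Sized k F → d ∈ F → 𝒬 (swap d e F) → 𝒬 F

module _ {k : ℕ} {𝒬 : Pred (Subset n) 0ℓ} (𝒬? : Decidable 𝒬) where

  card-𝒮∪ : Subset n → ℕ
  card-𝒮∪ T = card (𝒮 k T ∪ₚ 𝒬) (𝒮? k T ∪ₚ? 𝒬?)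

  card-𝒮∪-swap-≤ : ∀ {d e T} → ShiftClosed k e 𝒬 → d ∈ T → card-𝒮∪ T ≤ card-𝒮∪ (swap d e T)
  card-𝒮∪-swap-≤ {d} {e} {T} closed d∈T = card-≤-by-injection _ _ _ _
    (λ F → shift F (moved? F)) (λ {F} → into (moved? F)) (λ {F} {G} → injective (moved? F) (moved? G))
    where
    Moved : Pred (Subset n) 0ℓ
    Moved F = 𝒮 k T F × ¬ 𝒬 F
    moved? : Decidable Moved
    moved? = 𝒮? k T ∩? ∁? 𝒬?
    shift : ∀ F → Dec (Moved F) → Subset n
    shift F (yes _) = swap d e F
    shift F (no _)  = F
    unmoved⇒𝒬 : ∀ {F} → (𝒮 k T ∪ₚ 𝒬) F → ¬ Moved F → 𝒬 F
    unmoved⇒𝒬 (inj₂ F∈𝒬) _ = F∈𝒬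
    unmoved⇒𝒬 {F} (inj₁ F∈𝒮) unmoved with 𝒬? F
    ... | yes F∈𝒬 = F∈𝒬
    ... | no  F∉𝒬 = ⊥-elim (unmoved (F∈𝒮 , F∉𝒬))
    into : ∀ {F} (m : Dec (Moved F)) → (𝒮 k T ∪ₚ 𝒬) F → (𝒮 k (swap d e T) ∪ₚ 𝒬) (shift F m)
    into (yes ((∣F∣≡k , T⊆F) , _)) _ = inj₁ (trans (∣swap∣ (T⊆F d∈T)) ∣F∣≡k , swap-mono T⊆F)
    into (no unmoved)           F∈ = inj₂ (unmoved⇒𝒬 F∈ unmoved)
    -- a moved F cannot collide with an unmoved G, since G ∈ 𝒬 would put F back in 𝒬
    injective : ∀ {F G} (mF : Dec (Moved F)) (mG : Dec (Moved G)) →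
      (𝒮 k T ∪ₚ 𝒬) F → (𝒮 k T ∪ₚ 𝒬) G → shift F mF ≡ shift G mG → F ≡ G
    injective {F} {G} (yes _) (yes _) _ _ eq = begin
      F                         ≡⟨ swap-involutive d e F ⟨
      swap d e (swap d e F)     ≡⟨ cong (swap d e) eq ⟩
      swap d e (swap d e G)     ≡⟨ swap-involutive d e G ⟩
      G                         ∎
      where open ≡-Reasoning
    injective (no _) (no _) _ _ eq = eq
    injective (yes ((∣F∣≡k , T⊆F) , F∉𝒬)) (no unmoved) _ G∈ eq =
      ⊥-elim (F∉𝒬 (closed ∣F∣≡k (T⊆F d∈T) (subst 𝒬 (sym eq) (unmoved⇒𝒬 G∈ unmoved))))
    injective (no unmoved) (yes ((∣G∣≡k , T⊆G) , G∉𝒬)) F∈ _ eq =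
      ⊥-elim (G∉𝒬 (closed ∣G∣≡k (T⊆G d∈T) (subst 𝒬 eq (unmoved⇒𝒬 F∈ unmoved))))

  card-𝒮∪-shift-≤ : ∀ {T T*} → (∀ {e} → e ∈ T* → ShiftClosed k e 𝒬) →
    ∣ T ∣ ≡ ∣ T* ∣ → card-𝒮∪ T ≤ card-𝒮∪ T*
  card-𝒮∪-shift-≤ {T} {T*} closed = go (suc ∣ T* ─ T ∣) ≤-refl
    where
    go : ∀ m {T} → ∣ T* ─ T ∣ < m → ∣ T ∣ ≡ ∣ T* ∣ → card-𝒮∪ T ≤ card-𝒮∪ T*
    go (suc m) {T} (s≤s ∣T*─T∣≤m) ∣T∣≡∣T*∣ with nonempty? (T* ─ T) | nonempty? (T ─ T*)
    ... | no T*─T-empty | _ =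
      ≤-reflexive (cong card-𝒮∪ (sym (p⊆q∧∣p∣≡∣q∣⇒p≡q (Empty[p─q]⇒p⊆q T*─T-empty) (sym ∣T∣≡∣T*∣))))
    ... | yes (e , e∈T*─T) | no T─T*-empty =
      ⊥-elim (x∈p─q⇒x∉q e∈T*─T (subst (e ∈_) (sym T≡T*) (p─q⊆p _ _ e∈T*─T)))
      where
      T≡T* : T ≡ T*
      T≡T* = p⊆q∧∣p∣≡∣q∣⇒p≡q (Empty[p─q]⇒p⊆q T─T*-empty) ∣T∣≡∣T*∣
    ... | yes (e , e∈T*─T) | yes (d , d∈T─T*) = ≤-trans
      (card-𝒮∪-swap-≤ (closed e∈T*) d∈T)
      (go m (<-≤-trans (p⊂q⇒∣p∣<∣q∣ (swap-⊂-─ d∈T (x∈p─q⇒x∉q d∈T─T*) e∈T* (x∈p─q⇒x∉q e∈T*─T))) ∣T*─T∣≤m)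
            (trans (∣swap∣ d∈T) ∣T∣≡∣T*∣))
      where
      d∈T : d ∈ T
      d∈T = p─q⊆p _ _ d∈T─T*
      e∈T* : e ∈ T*
      e∈T* = p─q⊆p _ _ e∈T*─T

∪-shiftClosed : ∀ {k} {e : Fin n} {𝒫 𝒬} → ShiftClosed k e 𝒫 → ShiftClosed k e 𝒬 → ShiftClosed k e (𝒫 ∪ₚ 𝒬)
∪-shiftClosed 𝒫-closed _ ∣F∣≡k d∈F (inj₁ F∈𝒫) = inj₁ (𝒫-closed ∣F∣≡k d∈F F∈𝒫)
∪-shiftClosed _ 𝒬-closed ∣F∣≡k d∈F (inj₂ F∈𝒬) = inj₂ (𝒬-closed ∣F∣≡k d∈F F∈𝒬)

𝒮-shiftClosed : ∀ {k} {e : Fin n} {T} → e ∉ T → ShiftClosed k e (𝒮 k T)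
𝒮-shiftClosed e∉T ∣F∣≡k d∈F (_ , T⊆swap) = ∣F∣≡k , λ x∈T → swap-∈⇒∈ d∈F e∉T x∈T (T⊆swap x∈T)

⋃𝒮-shiftClosed : ∀ {k} {e : Fin n} Ts → e ∉ ⋃ Ts → ShiftClosed k e (⋃𝒮 k Ts)
⋃𝒮-shiftClosed []       _ _ _ ()
⋃𝒮-shiftClosed (T ∷ Ts) e∉ = ∪-shiftClosed
  (𝒮-shiftClosed (λ e∈T → e∉ (p⊆p∪q (⋃ Ts) e∈T)))
  (⋃𝒮-shiftClosed Ts (λ e∈ → e∉ (q⊆p∪q T (⋃ Ts) e∈)))

ℋ₁-shiftClosed : ∀ {k} {e : Fin n} {X C} → e ∉ C → e ∉ X → ShiftClosed k e (ℋ₁ k X C)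
ℋ₁-shiftClosed {X = X} {C} e∉C e∉X {F = F} ∣F∣≡k d∈F (_ , inj₁ (X⊆swap , x , x∈)) =
  ∣F∣≡k , inj₁ ((λ y∈X → swap-∈⇒∈ d∈F e∉X y∈X (X⊆swap y∈X)) , x , x∈p∩q⁺ (x∈F , x∈C─X))
  where
  x∈C─X : x ∈ C ─ X
  x∈C─X = proj₂ (x∈p∩q⁻ _ _ x∈)
  x∈F : x ∈ F
  x∈F = swap-∈⇒∈ d∈F e∉C (p─q⊆p C X x∈C─X) (proj₁ (x∈p∩q⁻ _ _ x∈))
ℋ₁-shiftClosed {e = e} {C = C} e∉C _ {d} {F} ∣F∣≡k d∈F (∣swap∣≡k , inj₂ (i , i∈C , swap≡C-i)) =
  ∣F∣≡k , inj₂ (i , i∈C , trans (sym swap≡F) swap≡C-i)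
  where
  -- swap d e F ⊆ C avoids e, so the swap moved nothing
  swap≡F : swap d e F ≡ F
  swap≡F = p⊆q∧∣p∣≡∣q∣⇒p≡q
    (λ x∈ → swap-∈⇒∈ d∈F e∉C (p─q⊆p C _ (subst (_ ∈_) swap≡C-i x∈)) x∈)
    (trans ∣swap∣≡k (sym ∣F∣≡k))

ℋ₂-shiftClosed : ∀ {k t} {e : Fin n} {Z} → e ∉ Z → ShiftClosed k e (ℋ₂ k t Z)
ℋ₂-shiftClosed {e = e} {Z} e∉Z {d} {F} ∣F∣≡k d∈F (_ , t<∣swap∩Z∣) =
  ∣F∣≡k , ≤-trans t<∣swap∩Z∣ (p⊆q⇒∣p∣≤∣q∣ swap∩Z⊆F∩Z)
  where
  swap∩Z⊆F∩Z : swap d e F ∩ Z ⊆ F ∩ Z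
  swap∩Z⊆F∩Z x∈ = let (x∈swap , x∈Z) = x∈p∩q⁻ _ _ x∈ in x∈p∩q⁺ (swap-∈⇒∈ d∈F e∉Z x∈Z x∈swap , x∈Z)

card-⋃𝒮∪-shift-≤ : ∀ {k} {𝒬 : Pred (Subset n) 0ℓ} (𝒬? : Decidable 𝒬) {T T* R} (Ts : List (Subset n)) →
  (∀ {e} → e ∉ R → ShiftClosed k e 𝒬) → Empty (T* ∩ (⋃ Ts ∪ R)) → ∣ T ∣ ≡ ∣ T* ∣ →
  card (⋃𝒮 k (T ∷ Ts) ∪ₚ 𝒬) (⋃𝒮? k (T ∷ Ts) ∪ₚ? 𝒬?) ≤ card (⋃𝒮 k (T* ∷ Ts) ∪ₚ 𝒬) (⋃𝒮? k (T* ∷ Ts) ∪ₚ? 𝒬?)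
card-⋃𝒮∪-shift-≤ {n} {k} {𝒬} 𝒬? {T} {T*} {R} Ts 𝒬-closed T*∩⋃Ts∪R-empty ∣T∣≡∣T*∣ =
  ≤-trans (card-mono (𝒢 T) (𝒮 k T ∪ₚ 𝒬′) (𝒢? T) (𝒮? k T ∪ₚ? 𝒬′?) assocʳ)
  (≤-trans (card-𝒮∪-shift-≤ 𝒬′? closed ∣T∣≡∣T*∣)
           (card-mono (𝒮 k T* ∪ₚ 𝒬′) (𝒢 T*) (𝒮? k T* ∪ₚ? 𝒬′?) (𝒢? T*) assocˡ))
  where
  𝒢 : Subset n → Pred (Subset n) 0ℓ
  𝒢 U = ⋃𝒮 k (U ∷ Ts) ∪ₚ 𝒬
  𝒢? : ∀ U → Decidable (𝒢 U)
  𝒢? U = ⋃𝒮? k (U ∷ Ts) ∪ₚ? 𝒬?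
  𝒬′ : Pred (Subset n) 0ℓ
  𝒬′ = ⋃𝒮 k Ts ∪ₚ 𝒬
  𝒬′? : Decidable 𝒬′
  𝒬′? = ⋃𝒮? k Ts ∪ₚ? 𝒬?
  closed : ∀ {e} → e ∈ T* → ShiftClosed k e 𝒬′
  closed {e} e∈T* = ∪-shiftClosed (⋃𝒮-shiftClosed Ts (λ e∈ → e∉ (p⊆p∪q R e∈)))
                                  (𝒬-closed (λ e∈ → e∉ (q⊆p∪q (⋃ Ts) R e∈)))
    where
    e∉ : e ∉ ⋃ Ts ∪ R
    e∉ e∈ = T*∩⋃Ts∪R-empty (e , x∈p∩q⁺ (e∈T* , e∈))

-- The inequalities hold without the Nonempty hypotheses and all size constraints but ∣ T₁ ∣ ≡ ∣ T₁* ∣.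
lemma2p6 : (n t k s : ℕ) → 1 ≤ t → t < k → k ≤ n → 2 ≤ s →
    (T₁ T₁* : Subset n) (Ts : Vec (Subset n) (s ∸ 2)) (X C Z : Subset n) →
    ∣ T₁ ∣ ≡ t → ∣ T₁* ∣ ≡ t → All (λ T → ∣ T ∣ ≡ t) Ts →
    ∣ X ∣ ≡ t → ∣ C ∣ ≡ suc k → X ⊆ C → ∣ Z ∣ ≡ suc (suc t) →
    ((Nonempty (T₁ ∩ (⋃ (toList Ts) ∪ C ∪ X)) → Empty (T₁* ∩ (⋃ (toList Ts) ∪ C ∪ X)) →
    ∣𝒢₁∣ k (T₁ ∷ toList Ts) X C ≤ ∣𝒢₁∣ k (T₁* ∷ toList Ts) X C)
    × (Nonempty (T₁ ∩ (⋃ (toList Ts) ∪ Z)) → Empty (T₁* ∩ (⋃ (toList Ts) ∪ Z)) →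
    ∣𝒢₂∣ k t (T₁ ∷ toList Ts) Z ≤ ∣𝒢₂∣ k t (T₁* ∷ toList Ts) Z))
lemma2p6 n t k s _ _ _ _ T₁ T₁* Ts X C Z ∣T₁∣≡t ∣T₁*∣≡t _ _ _ _ _ =
  (λ _ disjoint → card-⋃𝒮∪-shift-≤ (ℋ₁? k X C) (toList Ts) ℋ₁-closed disjoint ∣T₁∣≡∣T₁*∣) ,
  (λ _ disjoint → card-⋃𝒮∪-shift-≤ (ℋ₂? k t Z) (toList Ts) ℋ₂-shiftClosed disjoint ∣T₁∣≡∣T₁*∣)
  where
  ∣T₁∣≡∣T₁*∣ : ∣ T₁ ∣ ≡ ∣ T₁* ∣
  ∣T₁∣≡∣T₁*∣ = trans ∣T₁∣≡t (sym ∣T₁*∣≡t)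
  ℋ₁-closed : ∀ {e} → e ∉ C ∪ X → ShiftClosed k e (ℋ₁ k X C)
  ℋ₁-closed e∉C∪X = ℋ₁-shiftClosed (λ e∈C → e∉C∪X (p⊆p∪q X e∈C)) (λ e∈X → e∉C∪X (q⊆p∪q C X e∈X))
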